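{- Let $n\ge1$. For $1\le k\le n$ and $0\le d\le n-1$ define numbers $E_{n,k}(d)$ by the polynomial identity in $x$ $$\sum_{k=1}^{n}x^kE_{n,k}(d)=\binom{x+n-d-1}{n},$$ so that $E_{n,k}=\sum_{w\in S_n}E_{n,k}(d(w))\,w$ in the group algebra of $S_n$, where $d(w)$ is the number of descents of $w$. Then for $0\le i,j\le n-1$, $$u^n_j(i)=n!\,E_{n,n-j}(i),$$ where $u^n_j(i)=\sum_{k=n-j}^{n}s(n,k)\binom{k}{n-j}(n-1-i)^{k-(n-j)}$ (with $0^0=1$).
   Context: $\binom{x+n-d-1}{n}=\frac{(x+n-d-1)\cdots(x-d)}{n!}$ as a polynomial in $x$. A descent of $w\in S_n$ is an $i$ with $w(i+1)<w(i)$. $s(n,k)$ is the signed Stirling number of the first kind: $x(x-1)\cdots(x-n+1)=\sum_k s(n,k)x^k$. For any integer $b\ge2$, $(u^n_j(i))_{0\le i\le n-1}$ is a right eigenvector with eigenvalue $b^{ -j}$ of the carries matrix $M(i,j)=b^{ -n}\sum_{l=0}^{j-\lfloor i/b\rfloor}(-1)^l\binom{n+1}{l}\binom{n-1-i+(j+1-l)b}{n}$. The elements $E_{n,k}$ are orthogonal idempotents of the group algebra summing to the identity (Eulerian idempotents, up to the sign map). -}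

module Defs where

open import Data.Nat as ℕ using (ℕ; zero; suc; _∸_; _^_; _!)
open import Data.Nat.Properties using (_!≢0)
open import Data.Nat.Combinatorics using (_C_)
open import Data.Integer as ℤ using (ℤ; +_)
open import Data.Rational using (ℚ; 0ℚ; 1ℚ; _+_; _*_; -_; _/_)
open import Data.List using (List; []; _∷_; map)

-- Polynomials in x with rational coefficients, as coefficient lists,
-- lowest degree first:  a₀ ∷ a₁ ∷ … represents a₀ + a₁ x + …
Poly : Set
Poly = List ℚ

coeff : Poly → ℕ → ℚ
coeff []       _       = 0ℚ
coeff (a ∷ p)  zero    = a
coeff (a ∷ p)  (suc k) = coeff p k

addP : Poly → Poly → Poly
addP []      q       = q
addP p       []      = p
addP (a ∷ p) (b ∷ q) = (a + b) ∷ addP p q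

scaleP : ℚ → Poly → Poly
scaleP c = map (c *_)

mulLin : ℚ → Poly → Poly
mulLin a p = addP (0ℚ ∷ p) (scaleP a p)

ℕ→ℚ : ℕ → ℚ
ℕ→ℚ m = (+ m) / 1

prodLin : (ℕ → ℚ) → ℕ → Poly
prodLin f zero    = 1ℚ ∷ []
prodLin f (suc n) = mulLin (f n) (prodLin f n)

-- binom(x+n-d-1, n) = (x+n-d-1)⋯(x-d) / n!  as a polynomial in x
-- (factors x - d + m for m = 0 … n-1)
binomPoly : ℕ → ℕ → Poly
binomPoly n d = scaleP ((+ 1 / (n !)) {{n !≢0}})
                       (prodLin (λ m → ℕ→ℚ m + (- ℕ→ℚ d)) n)

E : ℕ → ℕ → ℕ → ℚ
E n k d = coeff (binomPoly n d) k

fallingPoly : ℕ → Poly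
fallingPoly n = prodLin (λ m → - ℕ→ℚ m) n

-- signed Stirling numbers of the first kind: x(x-1)⋯(x-n+1) = Σ_k s(n,k) x^k
s : ℕ → ℕ → ℚ
s n k = coeff (fallingPoly n) k

sumFrom : ℕ → ℕ → (ℕ → ℚ) → ℚ
sumFrom a zero      f = 0ℚ
sumFrom a (suc len) f = f a + sumFrom (suc a) len f

u : ℕ → ℕ → ℕ → ℚ
u n j i = sumFrom (n ∸ j) (suc j)
  (λ k → s n k * ℕ→ℚ ((k C (n ∸ j)) ℕ.* ((n ∸ 1 ∸ i) ^ (k ∸ (n ∸ j)))))

-- Write c = n-1-i and p = n-j.  By definition u^n_j(i) is the Taylor-shift
-- sum  Σ_k s(n,k) C(k,p) c^(k-p),  i.e. the coefficient of x^p in the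
-- falling factorial evaluated at x + c:
--     (x+c)(x+c-1)⋯(x+c-n+1)  =  ∏_{m<n} (x + (c - m)).
-- Listing the factors in reverse order (m ↦ n-1-m) this is
--     ∏_{m<n} (x + (m - i))  =  n! · binom(x+n-i-1, n),
-- whose coefficient of x^p is n! · E_{n,p}(i).
module Submission where

open import Defs
open import Data.Nat as ℕ using (ℕ; zero; suc; _≤_; _<_; _∸_; _^_; _!; z≤n; s≤s)
open import Data.Nat.Properties using (_!≢0)
import Data.Nat.Properties as ℕP
open import Data.Nat.Combinatorics using (_C_; k>n⇒nCk≡0; nCk+nC[k+1]≡[n+1]C[k+1])
open import Data.Integer as ℤ using (+_)
import Data.Integer.Properties as ℤP
open import Data.Rational using (ℚ; 0ℚ; 1ℚ; _+_; _*_; -_; _/_; toℚᵘ)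
open import Data.Rational.Properties
  using (toℚᵘ-injective; toℚᵘ-fromℚᵘ; toℚᵘ-homo-+; toℚᵘ-homo-*;
         +-identityˡ; +-identityʳ; *-zeroˡ; *-zeroʳ; *-identityˡ; *-assoc)
import Data.Rational.Unnormalised as ℚᵘ
import Data.Rational.Unnormalised.Properties as ℚᵘP
open import Data.Rational.Solver using (module +-*-Solver)
open +-*-Solver using (solve; _:+_; _:*_; :-_; _:=_)
open import Data.Sum using (inj₁; inj₂)
open import Data.List using ([]; _∷_)
open import Relation.Binary.PropositionalEquality
open ≡-Reasoning

ℕ→ℚ-unnormalised : ∀ m → toℚᵘ (ℕ→ℚ m) ℚᵘ.≃ ℚᵘ.mkℚᵘ (+ m) 0
ℕ→ℚ-unnormalised m = toℚᵘ-fromℚᵘ (ℚᵘ.mkℚᵘ (+ m) 0)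

ℕ→ℚ-+ : ∀ a b → ℕ→ℚ (a ℕ.+ b) ≡ ℕ→ℚ a + ℕ→ℚ b
ℕ→ℚ-+ a b = toℚᵘ-injective
  (ℚᵘP.≃-trans (ℕ→ℚ-unnormalised (a ℕ.+ b))
  (ℚᵘP.≃-trans (ℚᵘ.*≡* cross-multiplied)
  (ℚᵘP.≃-trans (ℚᵘP.≃-sym (ℚᵘP.+-cong (ℕ→ℚ-unnormalised a) (ℕ→ℚ-unnormalised b)))
               (ℚᵘP.≃-sym (toℚᵘ-homo-+ (ℕ→ℚ a) (ℕ→ℚ b))))))
  where
  cross-multiplied : + (a ℕ.+ b) ℤ.* + 1 ≡ (+ a ℤ.* + 1 ℤ.+ + b ℤ.* + 1) ℤ.* + 1
  cross-multiplied = begin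
    + (a ℕ.+ b) ℤ.* + 1                   ≡⟨ ℤP.*-identityʳ _ ⟩
    + a ℤ.+ + b                           ≡⟨ cong₂ ℤ._+_ (ℤP.*-identityʳ (+ a)) (ℤP.*-identityʳ (+ b)) ⟨
    + a ℤ.* + 1 ℤ.+ + b ℤ.* + 1           ≡⟨ ℤP.*-identityʳ _ ⟨
    (+ a ℤ.* + 1 ℤ.+ + b ℤ.* + 1) ℤ.* + 1 ∎

ℕ→ℚ-* : ∀ a b → ℕ→ℚ (a ℕ.* b) ≡ ℕ→ℚ a * ℕ→ℚ b
ℕ→ℚ-* a b = toℚᵘ-injective
  (ℚᵘP.≃-trans (ℕ→ℚ-unnormalised (a ℕ.* b))
  (ℚᵘP.≃-trans (ℚᵘ.*≡* (cong (ℤ._* + 1) (ℤP.pos-* a b)))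
  (ℚᵘP.≃-trans (ℚᵘP.≃-sym (ℚᵘP.*-cong (ℕ→ℚ-unnormalised a) (ℕ→ℚ-unnormalised b)))
               (ℚᵘP.≃-sym (toℚᵘ-homo-* (ℕ→ℚ a) (ℕ→ℚ b))))))

ℕ→ℚ-cancel : ∀ N .{{_ : ℕ.NonZero N}} x → ℕ→ℚ N * ((+ 1 / N) * x) ≡ x
ℕ→ℚ-cancel (suc m) x = begin
  ℕ→ℚ (suc m) * ((+ 1 / suc m) * x)  ≡⟨ *-assoc (ℕ→ℚ (suc m)) (+ 1 / suc m) x ⟨
  (ℕ→ℚ (suc m) * (+ 1 / suc m)) * x  ≡⟨ cong (_* x) inverse ⟩
  1ℚ * x                             ≡⟨ *-identityˡ x ⟩
  x                                  ∎
  where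
  denominator : suc (m ℕ.* 1 ℕ.* 1) ≡ suc (m ℕ.+ 0 ℕ.+ 0)
  denominator = cong suc (trans (ℕP.*-identityʳ (m ℕ.* 1))
    (trans (ℕP.*-identityʳ m) (sym (trans (ℕP.+-identityʳ (m ℕ.+ 0)) (ℕP.+-identityʳ m)))))
  inverse : ℕ→ℚ (suc m) * (+ 1 / suc m) ≡ 1ℚ
  inverse = toℚᵘ-injective
    (ℚᵘP.≃-trans (toℚᵘ-homo-* (ℕ→ℚ (suc m)) (+ 1 / suc m))
    (ℚᵘP.≃-trans (ℚᵘP.*-cong (ℕ→ℚ-unnormalised (suc m)) (toℚᵘ-fromℚᵘ (ℚᵘ.mkℚᵘ (+ 1) m)))
                 (ℚᵘ.*≡* (cong +_ denominator))))

ℕ→ℚ-∸-swap : ∀ {N m i} → m ≤ N → i ≤ N →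
  ℕ→ℚ (N ∸ m) + - ℕ→ℚ i ≡ ℕ→ℚ (N ∸ i) + - ℕ→ℚ m
ℕ→ℚ-∸-swap {N} {m} {i} m≤N i≤N = begin
  X + - I                  ≡⟨ solve 3 (λ X M I → X :+ :- I := (X :+ M) :+ (:- M :+ :- I)) refl X M I ⟩
  (X + M) + (- M + - I)    ≡⟨ cong (_+ (- M + - I)) both-equal-N ⟩
  (Y + I) + (- M + - I)    ≡⟨ solve 3 (λ Y M I → (Y :+ I) :+ (:- M :+ :- I) := Y :+ :- M) refl Y M I ⟩
  Y + - M                  ∎
  where
  X = ℕ→ℚ (N ∸ m)
  Y = ℕ→ℚ (N ∸ i)
  M = ℕ→ℚ m
  I = ℕ→ℚ i
  both-equal-N : X + M ≡ Y + I
  both-equal-N = begin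
    X + M                 ≡⟨ ℕ→ℚ-+ (N ∸ m) m ⟨
    ℕ→ℚ (N ∸ m ℕ.+ m)     ≡⟨ cong ℕ→ℚ (trans (ℕP.m∸n+n≡m m≤N) (sym (ℕP.m∸n+n≡m i≤N))) ⟩
    ℕ→ℚ (N ∸ i ℕ.+ i)     ≡⟨ ℕ→ℚ-+ (N ∸ i) i ⟩
    Y + I                 ∎

sum-cong : ∀ a len {f g : ℕ → ℚ} → (∀ k → f k ≡ g k) → sumFrom a len f ≡ sumFrom a len g
sum-cong a zero      f≡g = refl
sum-cong a (suc len) f≡g = cong₂ _+_ (f≡g a) (sum-cong (suc a) len f≡g)

sum-shift : ∀ a len f → sumFrom (suc a) len f ≡ sumFrom a len (λ k → f (suc k))
sum-shift a zero      f = refl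
sum-shift a (suc len) f = cong (_+_ (f (suc a))) (sum-shift (suc a) len f)

sum-zero : ∀ a len f → (∀ k → f k ≡ 0ℚ) → sumFrom a len f ≡ 0ℚ
sum-zero a zero      f f≡0 = refl
sum-zero a (suc len) f f≡0 =
  trans (cong₂ _+_ (f≡0 a) (sum-zero (suc a) len f f≡0)) (+-identityˡ 0ℚ)

sum-linear : ∀ a len c f g →
  sumFrom a len (λ k → f k + c * g k) ≡ sumFrom a len f + c * sumFrom a len g
sum-linear a zero      c f g = sym (trans (+-identityˡ (c * 0ℚ)) (*-zeroʳ c))
sum-linear a (suc len) c f g = begin
  (f a + c * g a) + sumFrom (suc a) len (λ k → f k + c * g k)
    ≡⟨ cong (_+_ (f a + c * g a)) (sum-linear (suc a) len c f g) ⟩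
  (f a + c * g a) + (F + c * G)
    ≡⟨ solve 5 (λ fa c ga F G → (fa :+ c :* ga) :+ (F :+ c :* G) := (fa :+ F) :+ c :* (ga :+ G))
             refl (f a) c (g a) F G ⟩
  (f a + F) + c * (g a + G) ∎
  where
  F = sumFrom (suc a) len f
  G = sumFrom (suc a) len g

sum-drop-zeros : ∀ a len f → (∀ k → k < a → f k ≡ 0ℚ) →
  sumFrom a len f ≡ sumFrom 0 (a ℕ.+ len) f
sum-drop-zeros zero    len f vanish = refl
sum-drop-zeros (suc a) len f vanish = begin
  sumFrom (suc a) len f                          ≡⟨ sum-shift a len f ⟩
  sumFrom a len (λ k → f (suc k))                ≡⟨ sum-drop-zeros a len (λ k → f (suc k)) (λ k k<a → vanish (suc k) (s≤s k<a)) ⟩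
  sumFrom 0 (a ℕ.+ len) (λ k → f (suc k))        ≡⟨ sum-shift 0 (a ℕ.+ len) f ⟨
  sumFrom 1 (a ℕ.+ len) f                        ≡⟨ +-identityˡ _ ⟨
  0ℚ + sumFrom 1 (a ℕ.+ len) f                   ≡⟨ cong (_+ sumFrom 1 (a ℕ.+ len) f) (vanish 0 (s≤s z≤n)) ⟨
  sumFrom 0 (suc a ℕ.+ len) f                    ∎

_≈P_ : Poly → Poly → Set
p ≈P q = ∀ k → coeff p k ≡ coeff q k

coeff-addP : ∀ p q k → coeff (addP p q) k ≡ coeff p k + coeff q k
coeff-addP []      q       k       = sym (+-identityˡ (coeff q k))
coeff-addP (a ∷ p) []      k       = sym (+-identityʳ (coeff (a ∷ p) k))
coeff-addP (a ∷ p) (b ∷ q) zero    = refl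
coeff-addP (a ∷ p) (b ∷ q) (suc k) = coeff-addP p q k

coeff-scaleP : ∀ c p k → coeff (scaleP c p) k ≡ c * coeff p k
coeff-scaleP c []      k       = sym (*-zeroʳ c)
coeff-scaleP c (a ∷ p) zero    = refl
coeff-scaleP c (a ∷ p) (suc k) = coeff-scaleP c p k

coeff-mulLin : ∀ a p k → coeff (mulLin a p) k ≡ coeff (0ℚ ∷ p) k + a * coeff p k
coeff-mulLin a p k = trans (coeff-addP (0ℚ ∷ p) (scaleP a p) k)
                           (cong (_+_ (coeff (0ℚ ∷ p) k)) (coeff-scaleP a p k))

coeff-x-mulLin : ∀ a p k → coeff (0ℚ ∷ mulLin a p) k ≡ coeff (0ℚ ∷ 0ℚ ∷ p) k + a * coeff (0ℚ ∷ p) k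
coeff-x-mulLin a p zero    = sym (trans (+-identityˡ (a * 0ℚ)) (*-zeroʳ a))
coeff-x-mulLin a p (suc k) = coeff-mulLin a p k

mulLin-cong : ∀ a p q → p ≈P q → mulLin a p ≈P mulLin a q
mulLin-cong a p q p≈q k = begin
  coeff (mulLin a p) k                      ≡⟨ coeff-mulLin a p k ⟩
  coeff (0ℚ ∷ p) k + a * coeff p k          ≡⟨ cong₂ (λ x y → x + a * y) (shifted k) (p≈q k) ⟩
  coeff (0ℚ ∷ q) k + a * coeff q k          ≡⟨ coeff-mulLin a q k ⟨
  coeff (mulLin a q) k                      ∎
  where
  shifted : (0ℚ ∷ p) ≈P (0ℚ ∷ q)
  shifted zero    = refl
  shifted (suc k) = p≈q k

mulLin-comm : ∀ a b p → mulLin a (mulLin b p) ≈P mulLin b (mulLin a p)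
mulLin-comm a b p k = begin
  coeff (mulLin a (mulLin b p)) k
    ≡⟨ coeff-mulLin a (mulLin b p) k ⟩
  coeff (0ℚ ∷ mulLin b p) k + a * coeff (mulLin b p) k
    ≡⟨ cong₂ _+_ (coeff-x-mulLin b p k) (cong (a *_) (coeff-mulLin b p k)) ⟩
  (X₂ + b * X₁) + a * (X₁ + b * X₀)
    ≡⟨ solve 5 (λ a b X₂ X₁ X₀ → (X₂ :+ b :* X₁) :+ a :* (X₁ :+ b :* X₀)
                              := (X₂ :+ a :* X₁) :+ b :* (X₁ :+ a :* X₀)) refl a b X₂ X₁ X₀ ⟩
  (X₂ + a * X₁) + b * (X₁ + a * X₀)
    ≡⟨ cong₂ _+_ (coeff-x-mulLin a p k) (cong (b *_) (coeff-mulLin a p k)) ⟨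
  coeff (0ℚ ∷ mulLin a p) k + b * coeff (mulLin a p) k
    ≡⟨ coeff-mulLin b (mulLin a p) k ⟨
  coeff (mulLin b (mulLin a p)) k ∎
  where
  X₂ = coeff (0ℚ ∷ 0ℚ ∷ p) k
  X₁ = coeff (0ℚ ∷ p) k
  X₀ = coeff p k

prodLin-cong : ∀ {f g} n → (∀ m → m < n → f m ≡ g m) → prodLin f n ≈P prodLin g n
prodLin-cong zero    f≡g k = refl
prodLin-cong {f} {g} (suc n) f≡g k = begin
  coeff (mulLin (f n) (prodLin f n)) k
    ≡⟨ mulLin-cong (f n) (prodLin f n) (prodLin g n) (prodLin-cong n (λ m m<n → f≡g m (ℕP.m<n⇒m<1+n m<n))) k ⟩
  coeff (mulLin (f n) (prodLin g n)) k
    ≡⟨ cong (λ a → coeff (mulLin a (prodLin g n)) k) (f≡g n (ℕP.n<1+n n)) ⟩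
  coeff (mulLin (g n) (prodLin g n)) k ∎

consFactor : ℚ → (ℕ → ℚ) → ℕ → ℚ
consFactor a f zero    = a
consFactor a f (suc m) = f m

prodLin-consFactor : ∀ a f n → mulLin a (prodLin f n) ≈P prodLin (consFactor a f) (suc n)
prodLin-consFactor a f zero    k = refl
prodLin-consFactor a f (suc n) k = begin
  coeff (mulLin a (mulLin (f n) (prodLin f n))) k
    ≡⟨ mulLin-comm a (f n) (prodLin f n) k ⟩
  coeff (mulLin (f n) (mulLin a (prodLin f n))) k
    ≡⟨ mulLin-cong (f n) (mulLin a (prodLin f n)) (prodLin (consFactor a f) (suc n)) (prodLin-consFactor a f n) k ⟩
  coeff (prodLin (consFactor a f) (suc (suc n))) k ∎

prodLin-reverse : ∀ f n → prodLin f n ≈P prodLin (λ m → f (n ∸ suc m)) n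
prodLin-reverse f zero    k = refl
prodLin-reverse f (suc n) k = begin
  coeff (mulLin (f n) (prodLin f n)) k
    ≡⟨ mulLin-cong (f n) (prodLin f n) (prodLin reversed n) (prodLin-reverse f n) k ⟩
  coeff (mulLin (f n) (prodLin reversed n)) k
    ≡⟨ prodLin-consFactor (f n) reversed n k ⟩
  coeff (prodLin (consFactor (f n) reversed) (suc n)) k
    ≡⟨ prodLin-cong (suc n) same-factors k ⟩
  coeff (prodLin (λ m → f (suc n ∸ suc m)) (suc n)) k ∎
  where
  reversed = λ m → f (n ∸ suc m)
  same-factors : ∀ m → m < suc n → consFactor (f n) reversed m ≡ f (suc n ∸ suc m)
  same-factors zero    _ = refl
  same-factors (suc m) _ = refl

-- Taylor-shift weights: (x + c)^k = Σ_p C(k,p) c^(k-p) x^p.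
taylorWeight : ℕ → ℕ → ℕ → ℕ
taylorWeight c k p = (k C p) ℕ.* (c ^ (k ∸ p))

-- The weights of x·(x + c)^k, i.e. taylorWeight shifted up by one degree.
shiftedWeight : ℕ → ℕ → ℕ → ℕ
shiftedWeight c k zero    = 0
shiftedWeight c k (suc p) = taylorWeight c k p

-- Pascal recurrence, from (x + c)^(k+1) = x·(x + c)^k + c·(x + c)^k.
taylorWeight-suc : ∀ c k p →
  taylorWeight c (suc k) p ≡ shiftedWeight c k p ℕ.+ c ℕ.* taylorWeight c k p
taylorWeight-suc c k zero =
  trans (ℕP.*-identityˡ (c ^ suc k)) (cong (c ℕ.*_) (sym (ℕP.*-identityˡ (c ^ k))))
taylorWeight-suc c k (suc q) = begin
  (suc k C suc q) ℕ.* c ^ (k ∸ q)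
    ≡⟨ cong (ℕ._* c ^ (k ∸ q)) (nCk+nC[k+1]≡[n+1]C[k+1] k q) ⟨
  (k C q ℕ.+ k C suc q) ℕ.* c ^ (k ∸ q)
    ≡⟨ ℕP.*-distribʳ-+ (c ^ (k ∸ q)) (k C q) (k C suc q) ⟩
  (k C q) ℕ.* c ^ (k ∸ q) ℕ.+ (k C suc q) ℕ.* c ^ (k ∸ q)
    ≡⟨ cong ((k C q) ℕ.* c ^ (k ∸ q) ℕ.+_) top-term ⟩
  taylorWeight c k q ℕ.+ c ℕ.* taylorWeight c k (suc q) ∎
  where
  top-term : (k C suc q) ℕ.* c ^ (k ∸ q) ≡ c ℕ.* ((k C suc q) ℕ.* c ^ (k ∸ suc q))
  top-term with ℕP.≤-<-connex k q
  ... | inj₁ k≤q rewrite k>n⇒nCk≡0 (s≤s k≤q) = sym (ℕP.*-zeroʳ c)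
  ... | inj₂ q<k = begin
    K ℕ.* c ^ (k ∸ q)            ≡⟨ cong (λ e → K ℕ.* c ^ e) (ℕP.+-∸-assoc 1 q<k) ⟩
    K ℕ.* (c ℕ.* X)              ≡⟨ ℕP.*-assoc K c X ⟨
    (K ℕ.* c) ℕ.* X              ≡⟨ cong (ℕ._* X) (ℕP.*-comm K c) ⟩
    (c ℕ.* K) ℕ.* X              ≡⟨ ℕP.*-assoc c K X ⟩
    c ℕ.* (K ℕ.* X)              ∎
    where
    K = k C suc q
    X = c ^ (k ∸ suc q)

sum-mulLin : ∀ a p B (g : ℕ → ℚ) →
  sumFrom 0 (suc B) (λ k → coeff (mulLin a p) k * g k)
    ≡ sumFrom 0 B (λ k → coeff p k * g (suc k)) + a * sumFrom 0 (suc B) (λ k → coeff p k * g k)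
sum-mulLin a p B g = begin
  sumFrom 0 (suc B) (λ k → coeff (mulLin a p) k * g k)
    ≡⟨ sum-cong 0 (suc B) termwise ⟩
  sumFrom 0 (suc B) (λ k → coeff (0ℚ ∷ p) k * g k + a * (coeff p k * g k))
    ≡⟨ sum-linear 0 (suc B) a (λ k → coeff (0ℚ ∷ p) k * g k) (λ k → coeff p k * g k) ⟩
  sumFrom 0 (suc B) (λ k → coeff (0ℚ ∷ p) k * g k) + a * sumFrom 0 (suc B) (λ k → coeff p k * g k)
    ≡⟨ cong (_+ a * sumFrom 0 (suc B) (λ k → coeff p k * g k)) x-part ⟩
  sumFrom 0 B (λ k → coeff p k * g (suc k)) + a * sumFrom 0 (suc B) (λ k → coeff p k * g k) ∎
  where
  termwise : ∀ k → coeff (mulLin a p) k * g k ≡ coeff (0ℚ ∷ p) k * g k + a * (coeff p k * g k)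
  termwise k = trans (cong (_* g k) (coeff-mulLin a p k))
    (solve 4 (λ X a P g → (X :+ a :* P) :* g := X :* g :+ a :* (P :* g)) refl
           (coeff (0ℚ ∷ p) k) a (coeff p k) (g k))
  -- the constant coefficient of x·p is zero
  x-part : sumFrom 0 (suc B) (λ k → coeff (0ℚ ∷ p) k * g k) ≡ sumFrom 0 B (λ k → coeff p k * g (suc k))
  x-part = trans (cong (_+ sumFrom 1 B (λ k → coeff (0ℚ ∷ p) k * g k)) (*-zeroˡ (g 0)))
                 (trans (+-identityˡ _) (sum-shift 0 B (λ k → coeff (0ℚ ∷ p) k * g k)))

prodLin-shift : ∀ c f n B → n < B → ∀ p →
  coeff (prodLin (λ m → ℕ→ℚ c + f m) n) p
    ≡ sumFrom 0 B (λ k → coeff (prodLin f n) k * ℕ→ℚ (taylorWeight c k p))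
prodLin-shift c f zero (suc B) _ p = sym (trans (cong (_+_ (1ℚ * ℕ→ℚ (taylorWeight c 0 p))) higher-terms) (constant p))
  where
  higher-terms : sumFrom 1 B (λ k → coeff (1ℚ ∷ []) k * ℕ→ℚ (taylorWeight c k p)) ≡ 0ℚ
  higher-terms = trans (sum-shift 0 B _) (sum-zero 0 B _ (λ k → *-zeroˡ (ℕ→ℚ (taylorWeight c (suc k) p))))
  constant : ∀ p → 1ℚ * ℕ→ℚ (taylorWeight c 0 p) + 0ℚ ≡ coeff (1ℚ ∷ []) p
  constant zero    = refl
  constant (suc p) = refl
prodLin-shift c f (suc n) (suc B) (s≤s n<B) p = begin
  coeff (mulLin (cq + a) Q) p
    ≡⟨ coeff-mulLin (cq + a) Q p ⟩
  coeff (0ℚ ∷ Q) p + (cq + a) * coeff Q p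
    ≡⟨ solve 4 (λ X c a Y → X :+ (c :+ a) :* Y := (X :+ c :* Y) :+ a :* Y) refl (coeff (0ℚ ∷ Q) p) cq a (coeff Q p) ⟩
  (coeff (0ℚ ∷ Q) p + cq * coeff Q p) + a * coeff Q p
    ≡⟨ cong₂ _+_ (cong₂ (λ x y → x + cq * y) (x-part p) (prodLin-shift c f n B n<B p))
                 (cong (a *_) (prodLin-shift c f n (suc B) (ℕP.m<n⇒m<1+n n<B) p)) ⟩
  (pairing B (λ k → shiftedWeight c k p) + cq * pairing B (λ k → taylorWeight c k p)) + a * pairing (suc B) (λ k → taylorWeight c k p)
    ≡⟨ cong (_+ a * pairing (suc B) (λ k → taylorWeight c k p)) pascal ⟨
  pairing B (λ k → taylorWeight c (suc k) p) + a * pairing (suc B) (λ k → taylorWeight c k p)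
    ≡⟨ sum-mulLin a P B (λ k → ℕ→ℚ (taylorWeight c k p)) ⟨
  sumFrom 0 (suc B) (λ k → coeff (mulLin a P) k * ℕ→ℚ (taylorWeight c k p)) ∎
  where
  cq = ℕ→ℚ c
  a = f n
  P = prodLin f n
  Q = prodLin (λ m → ℕ→ℚ c + f m) n
  pairing : ℕ → (ℕ → ℕ) → ℚ
  pairing len v = sumFrom 0 len (λ k → coeff P k * ℕ→ℚ (v k))
  x-part : ∀ p → coeff (0ℚ ∷ Q) p ≡ pairing B (λ k → shiftedWeight c k p)
  x-part zero    = sym (sum-zero 0 B _ (λ k → *-zeroʳ (coeff P k)))
  x-part (suc p) = prodLin-shift c f n B n<B p
  pascal : pairing B (λ k → taylorWeight c (suc k) p)
         ≡ pairing B (λ k → shiftedWeight c k p) + cq * pairing B (λ k → taylorWeight c k p)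
  pascal = trans (sum-cong 0 B termwise)
                 (sum-linear 0 B cq (λ k → coeff P k * ℕ→ℚ (shiftedWeight c k p))
                                    (λ k → coeff P k * ℕ→ℚ (taylorWeight c k p)))
    where
    termwise : ∀ k → coeff P k * ℕ→ℚ (taylorWeight c (suc k) p)
                   ≡ coeff P k * ℕ→ℚ (shiftedWeight c k p) + cq * (coeff P k * ℕ→ℚ (taylorWeight c k p))
    termwise k = begin
      coeff P k * ℕ→ℚ (taylorWeight c (suc k) p)
        ≡⟨ cong (λ t → coeff P k * ℕ→ℚ t) (taylorWeight-suc c k p) ⟩
      coeff P k * ℕ→ℚ (shiftedWeight c k p ℕ.+ c ℕ.* taylorWeight c k p)
        ≡⟨ cong (coeff P k *_) (trans (ℕ→ℚ-+ (shiftedWeight c k p) (c ℕ.* taylorWeight c k p)) (cong (_+_ (ℕ→ℚ (shiftedWeight c k p))) (ℕ→ℚ-* c (taylorWeight c k p)))) ⟩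
      coeff P k * (ℕ→ℚ (shiftedWeight c k p) + cq * ℕ→ℚ (taylorWeight c k p))
        ≡⟨ solve 4 (λ P S c T → P :* (S :+ c :* T) := P :* S :+ c :* (P :* T)) refl
                 (coeff P k) (ℕ→ℚ (shiftedWeight c k p)) cq (ℕ→ℚ (taylorWeight c k p)) ⟩
      coeff P k * ℕ→ℚ (shiftedWeight c k p) + cq * (coeff P k * ℕ→ℚ (taylorWeight c k p)) ∎

corollary3p2 : (n : ℕ) → 1 ≤ n → (i j : ℕ) → i < n → j < n →
    u n j i ≡ ℕ→ℚ (n !) * E n (n ∸ j) i
corollary3p2 (suc n) _ i j (s≤s i≤n) (s≤s j≤n) = begin
  u (suc n) j i
    ≡⟨ sum-drop-zeros p (suc j) term below-p-vanish ⟩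
  sumFrom 0 (p ℕ.+ suc j) term
    ≡⟨ cong (λ len → sumFrom 0 len term) full-range ⟩
  sumFrom 0 (suc (suc n)) term
    ≡⟨ prodLin-shift c (λ m → - ℕ→ℚ m) (suc n) (suc (suc n)) (ℕP.n<1+n (suc n)) p ⟨
  coeff (prodLin (λ m → ℕ→ℚ c + - ℕ→ℚ m) (suc n)) p
    ≡⟨ prodLin-cong (suc n) (λ m m<n → sym (ℕ→ℚ-∸-swap (ℕP.≤-pred m<n) i≤n)) p ⟩
  coeff (prodLin (λ m → factor (suc n ∸ suc m)) (suc n)) p
    ≡⟨ prodLin-reverse factor (suc n) p ⟨
  coeff (prodLin factor (suc n)) p
    ≡⟨ ℕ→ℚ-cancel (suc n !) {{suc n !≢0}} (coeff (prodLin factor (suc n)) p) ⟨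
  ℕ→ℚ (suc n !) * ((+ 1 / suc n !) {{suc n !≢0}} * coeff (prodLin factor (suc n)) p)
    ≡⟨ cong (ℕ→ℚ (suc n !) *_) (coeff-scaleP ((+ 1 / suc n !) {{suc n !≢0}}) (prodLin factor (suc n)) p) ⟨
  ℕ→ℚ (suc n !) * E (suc n) p i ∎
  where
  p = suc n ∸ j
  c = n ∸ i
  -- the factors x + (m - i) of  n! · binom(x+n-i-1, n)
  factor : ℕ → ℚ
  factor m = ℕ→ℚ m + - ℕ→ℚ i
  term : ℕ → ℚ
  term k = s (suc n) k * ℕ→ℚ (taylorWeight c k p)
  below-p-vanish : ∀ k → k < p → term k ≡ 0ℚ
  below-p-vanish k k<p =
    trans (cong (λ t → s (suc n) k * ℕ→ℚ (t ℕ.* c ^ (k ∸ p))) (k>n⇒nCk≡0 k<p)) (*-zeroʳ (s (suc n) k))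
  full-range : p ℕ.+ suc j ≡ suc (suc n)
  full-range = trans (ℕP.+-suc p j) (cong suc (ℕP.m∸n+n≡m (ℕP.m≤n⇒m≤1+n j≤n)))
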